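{- Let $M$ be a $2\times 2$ matrix over $\{0,1,\ast\}$ with $M_{1,1}=M_{2,2}=0$ and $M\neq M_1=\begin{pmatrix}0&\ast\\ \ast&0\end{pmatrix}$. Then there are only finitely many minimal $M$-obstructions. More precisely, for the matrices $$M_2=\begin{pmatrix}0&0\\ \ast&0\end{pmatrix},\ M_3=\begin{pmatrix}0&1\\ \ast&0\end{pmatrix},\ M_4=\begin{pmatrix}0&0\\ 1&0\end{pmatrix},\ M_5=\begin{pmatrix}0&1\\ 1&0\end{pmatrix},\ M_6=\begin{pmatrix}0&0\\ 0&0\end{pmatrix}$$ the minimal $M_i$-obstructions (up to isomorphism) are exactly the following: (i) for $M_2$: the digon; the directed path $x\to y\to z$ on three vertices with $x,z$ non-adjacent; the transitive tournament on three vertices; the directed $3$-cycle; (ii) for $M_3$: every digraph on three vertices whose underlying graph is the triangle $K_3$; every digraph on three vertices whose underlying graph is $K_1+K_2$ (one edge and an isolated vertex); the directed path $x\to y\to z$ on three vertices with $x,z$ non-adjacent (all arcs asymmetric); and the digraph on vertices $x,y,x',y'$ whose arcs are exactly $(x,y)$, $(y',x')$, $(x,y'),(y',x)$, $(x',y),(y,x')$ (so its underlying graph is the $4$-cycle $x\,y\,x'\,y'$, with two opposite asymmetric arcs $x\to y$, $y'\to x'$ and the other two edges digons); (iii) for $M_4$: the digon; the transitive tournament on three vertices; the directed $3$-cycle; the digraph on three vertices consisting of one asymmetric arc and an isolated vertex; the directed path $x\to y\to z$ with $x,z$ non-adjacent; (iv) for $M_5$: the asymmetric arc (two vertices, exactly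 one arc); the biorientation of $K_3$; the biorientation of $K_1+K_2$; (v) for $M_6$: the asymmetric arc and the digon.
   Context: Digraphs have no loops and no multiple arcs in the same direction. A digon is a pair of vertices joined by arcs in both directions (also the digraph on two vertices with both arcs); an asymmetric arc is an arc $(x,y)$ with $(y,x)$ absent. The underlying graph of a digraph has an edge $xy$ whenever $(x,y)$ or $(y,x)$ is an arc. The biorientation of a graph $G$ replaces each edge by arcs in both directions. $K_1+K_2$ denotes the disjoint union of a vertex and an edge. Given a $2\times2$ matrix $M$ over $\{0,1,\ast\}$, an $M$-partition of a digraph $D$ is a partition of $V_D$ into parts $V_1,V_2$ (possibly empty) such that: for each $i$, two distinct vertices of $V_i$ are non-adjacent if $M_{i,i}=0$, and joined by arcs in both directions if $M_{i,i}=1$; for $i\neq j$, every vertex of $V_i$ has an arc to every vertex of $V_j$ if $M_{i,j}=1$, and no vertex of $V_i$ has an arc to any vertex of $V_j$ if $M_{i,j}=0$; $\ast$ imposes no restriction. A minimal $M$-obstruction is a digraph that admits no $M$-partition but every proper induced subdigraph of which admits one. -}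

module Defs where

open import Data.Nat using (ℕ; _<_)
open import Data.Fin using (Fin; zero; suc)
open import Data.Bool using (Bool; true; false; _∨_)
open import Data.Unit using (⊤)
open import Data.Empty using (⊥)
open import Data.Product using (Σ; _×_; _,_; ∃)
open import Data.Sum using (_⊎_)
open import Data.List using (List)
open import Data.List.Relation.Unary.Any using (Any)
open import Relation.Nullary using (¬_)
open import Relation.Binary.PropositionalEquality using (_≡_; _≢_; refl)
open import Function.Definitions using (Injective)

record Digraph : Set where
  constructor digraph
  field
    n        : ℕ
    arc      : Fin n → Fin n → Bool
    loopless : ∀ i → arc i i ≡ false
open Digraph public

adj : (D : Digraph) → Fin (n D) → Fin (n D) → Bool
adj D u v = arc D u v ∨ arc D v u

record _≅_ (D E : Digraph) : Set where
  field
    to       : Fin (n D) → Fin (n E)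
    from     : Fin (n E) → Fin (n D)
    from∘to  : ∀ u → from (to u) ≡ u
    to∘from  : ∀ v → to (from v) ≡ v
    preserve : ∀ u v → arc E (to u) (to v) ≡ arc D u v

induced : (D : Digraph) {m : ℕ} → (Fin m → Fin (n D)) → Digraph
induced D {m} f = digraph m (λ i j → arc D (f i) (f j)) (λ i → loopless D (f i))

data Entry : Set where
  e0 e1 e* : Entry

record Matrix : Set where
  constructor mat
  field
    m11 m12 m21 m22 : Entry
open Matrix public

entry : Matrix → Fin 2 → Fin 2 → Entry
entry M zero zero = m11 M
entry M zero (suc zero) = m12 M
entry M (suc zero) zero = m21 M
entry M (suc zero) (suc zero) = m22 M

-- what an entry demands of the arc from a vertex of V_i to a vertex of V_j
Respects : Entry → Bool → Set
Respects e0 b = b ≡ false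
Respects e1 b = b ≡ true
Respects e* b = ⊤

-- M-partition: part u = the index (0 ↦ V_1, 1 ↦ V_2) of the part containing u.
-- For distinct u, v in parts i, j, the arc (u,v) must respect M_{i,j}.
record MPartition (M : Matrix) (D : Digraph) : Set where
  field
    part : Fin (n D) → Fin 2
    ok   : ∀ u v → u ≢ v → Respects (entry M (part u) (part v)) (arc D u v)

MinObs : Matrix → Digraph → Set
MinObs M D =
  ¬ MPartition M D ×
  (∀ (m : ℕ) (f : Fin m → Fin (n D)) → Injective _≡_ _≡_ f → m < n D →
     MPartition M (induced D f))

M1 M2 M3 M4 M5 M6 : Matrix
M1 = mat e0 e* e* e0
M2 = mat e0 e0 e* e0
M3 = mat e0 e1 e* e0
M4 = mat e0 e0 e1 e0
M5 = mat e0 e1 e1 e0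
M6 = mat e0 e0 e0 e0

digonArc : Fin 2 → Fin 2 → Bool
digonArc zero (suc zero) = true
digonArc (suc zero) zero = true
digonArc _ _ = false

digon : Digraph
digon = digraph 2 digonArc λ { zero → refl ; (suc zero) → refl }

asymArcArc : Fin 2 → Fin 2 → Bool
asymArcArc zero (suc zero) = true
asymArcArc _ _ = false

asymArc : Digraph
asymArc = digraph 2 asymArcArc λ { zero → refl ; (suc zero) → refl }

loop3 : (a : Fin 3 → Fin 3 → Bool) → a zero zero ≡ false →
        a (suc zero) (suc zero) ≡ false → a (suc (suc zero)) (suc (suc zero)) ≡ false →
        ∀ i → a i i ≡ false
loop3 a p q r zero = p
loop3 a p q r (suc zero) = q
loop3 a p q r (suc (suc zero)) = r

P3Arc : Fin 3 → Fin 3 → Bool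
P3Arc zero (suc zero) = true
P3Arc (suc zero) (suc (suc zero)) = true
P3Arc _ _ = false

P3 : Digraph
P3 = digraph 3 P3Arc (loop3 P3Arc refl refl refl)

TT3Arc : Fin 3 → Fin 3 → Bool
TT3Arc zero (suc zero) = true
TT3Arc (suc zero) (suc (suc zero)) = true
TT3Arc zero (suc (suc zero)) = true
TT3Arc _ _ = false

TT3 : Digraph
TT3 = digraph 3 TT3Arc (loop3 TT3Arc refl refl refl)

C3Arc : Fin 3 → Fin 3 → Bool
C3Arc zero (suc zero) = true
C3Arc (suc zero) (suc (suc zero)) = true
C3Arc (suc (suc zero)) zero = true
C3Arc _ _ = false

C3 : Digraph
C3 = digraph 3 C3Arc (loop3 C3Arc refl refl refl)

arcK1Arc : Fin 3 → Fin 3 → Bool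
arcK1Arc zero (suc zero) = true
arcK1Arc _ _ = false

arcK1 : Digraph
arcK1 = digraph 3 arcK1Arc (loop3 arcK1Arc refl refl refl)

biK3Arc : Fin 3 → Fin 3 → Bool
biK3Arc zero zero = false
biK3Arc (suc zero) (suc zero) = false
biK3Arc (suc (suc zero)) (suc (suc zero)) = false
biK3Arc _ _ = true

biK3 : Digraph
biK3 = digraph 3 biK3Arc (loop3 biK3Arc refl refl refl)

biK1K2Arc : Fin 3 → Fin 3 → Bool
biK1K2Arc zero (suc zero) = true
biK1K2Arc (suc zero) zero = true
biK1K2Arc _ _ = false

biK1K2 : Digraph
biK1K2 = digraph 3 biK1K2Arc (loop3 biK1K2Arc refl refl refl)

-- vertices x = 0, y = 1, x' = 2, y' = 3; arcs exactly
-- (x,y), (y',x'), (x,y'), (y',x), (x',y), (y,x')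
C4Arc : Fin 4 → Fin 4 → Bool
C4Arc zero (suc zero) = true
C4Arc (suc (suc (suc zero))) (suc (suc zero)) = true
C4Arc zero (suc (suc (suc zero))) = true
C4Arc (suc (suc (suc zero))) zero = true
C4Arc (suc (suc zero)) (suc zero) = true
C4Arc (suc zero) (suc (suc zero)) = true
C4Arc _ _ = false

C4Arc-loopless : ∀ i → C4Arc i i ≡ false
C4Arc-loopless zero = refl
C4Arc-loopless (suc zero) = refl
C4Arc-loopless (suc (suc zero)) = refl
C4Arc-loopless (suc (suc (suc zero))) = refl

C4mixed : Digraph
C4mixed = digraph 4 C4Arc C4Arc-loopless

UnderlyingK3 : Digraph → Set
UnderlyingK3 D = Σ (n D ≡ 3) λ _ → ∀ u v → u ≢ v → adj D u v ≡ true

UnderlyingK1K2 : Digraph → Set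
UnderlyingK1K2 D =
  Σ (n D ≡ 3) λ _ →
  Σ (Fin (n D)) λ a → Σ (Fin (n D)) λ b →
    a ≢ b × adj D a b ≡ true ×
    (∀ u v → adj D u v ≡ true → (u ≡ a × v ≡ b) ⊎ (u ≡ b × v ≡ a))

_⟺_ : Set → Set → Set
P ⟺ Q = (P → Q) × (Q → P)
infix 1 _⟺_

-- A minimal M-obstruction containing an induced copy of a digraph H without M-partition is
-- isomorphic to H. So for each of M₂, …, M₆ it suffices (a) to check by exhaustive search that each
-- listed digraph has no M-partition while all its one-vertex deletions have one, and (b) to
-- partition explicitly every digraph with no induced listed digraph: by having an out-neighbour for
-- M₂ and M₄; for M₃ and M₅ by adjacency to a fixed vertex, which is a complete bipartition of the
-- underlying graph once it has no induced K₃ and K₁ + K₂, and which for M₃ is oriented one way or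
-- the other unless an induced P3 or C4mixed appears. The other admissible matrices besides M₁ are
-- transposes of M₂, M₃, M₄, and the Mᵀ-partitions of D are exactly the M-partitions of its converse.
module Submission where

open import Defs
open import Data.Bool using (Bool; true; false; _∨_; not)
open import Data.Bool.Properties using (¬-not; not-¬; ∨-idem; ∨-comm; ∨-zeroʳ)
import Data.Bool.Properties as Bool
open import Data.Empty using (⊥)
open import Data.Fin using (Fin; zero; suc; punchIn; punchOut; #_)
open import Data.Fin.Properties
  using (_≟_; any?; all?; ¬∀⟶∃¬; injective⇒≤; cantor-schröder-bernstein;
         punchOut-injective; punchIn-punchOut; pigeonhole; <⇒≢)
open import Data.List using (List; []; _∷_; _++_; map; cartesianProductWith; allFin)
open import Data.List.Membership.Propositional using (_∈_; find; lose)
open import Data.List.Membership.Propositional.Properties using (∈-cartesianProductWith⁺; ∈-allFin)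
open import Data.List.Relation.Unary.All as All using (All; []; _∷_)
open import Data.List.Relation.Unary.All.Properties using (¬Any⇒All¬)
open import Data.List.Relation.Unary.Any as Any using (Any; here; there)
import Data.List.Relation.Unary.Any.Properties as Any
open import Data.Nat using (ℕ; zero; suc; _≤_; _<_; s≤s; _<?_)
open import Data.Nat.Properties using (≮⇒≥; <⇒≱; <⇒≤; ≤-pred; n<1+n)
open import Data.Product using (Σ; ∃; _×_; _,_; proj₁; proj₂)
open import Data.Sum using (_⊎_; inj₁; inj₂)
open import Data.Unit using (tt)
open import Data.Vec using (Vec; []; _∷_; lookup; tabulate)
open import Data.Vec.Properties using (lookup∘tabulate)
open import Function using (_∘_)
open import Function.Definitions using (Injective)
open import Relation.Binary.PropositionalEquality
  using (_≡_; _≢_; refl; sym; trans; cong; cong₂; subst; subst₂; _≗_)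
open import Relation.Nullary using (¬_; Dec; yes; no; does; contradiction)
open import Relation.Nullary.Decidable using (True; toWitness; map′; _×-dec_; _→-dec_; ¬?; _⊎-dec_)

private
  variable
    M : Matrix
    D E H : Digraph
    k m : ℕ

≅-refl : D ≅ D
≅-refl = record
  { to = λ u → u ; from = λ u → u ; from∘to = λ _ → refl ; to∘from = λ _ → refl ; preserve = λ _ _ → refl }

≅-sym : D ≅ E → E ≅ D
≅-sym {D} {E} i = record
  { to = from ; from = to ; from∘to = to∘from ; to∘from = from∘to
  ; preserve = λ u v → trans (sym (preserve (from u) (from v))) (cong₂ (arc E) (to∘from u) (to∘from v)) }
  where open _≅_ i

≅-trans : D ≅ E → E ≅ H → D ≅ H
≅-trans i j = record
  { to = J.to ∘ I.to ; from = I.from ∘ J.from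
  ; from∘to = λ u → trans (cong I.from (J.from∘to (I.to u))) (I.from∘to u)
  ; to∘from = λ u → trans (cong J.to (I.to∘from (J.from u))) (J.to∘from u)
  ; preserve = λ u v → trans (J.preserve (I.to u) (I.to v)) (I.preserve u v) }
  where module I = _≅_ i ; module J = _≅_ j

≅-to-injective : (i : D ≅ E) → Injective _≡_ _≡_ (_≅_.to i)
≅-to-injective i {u} {v} eq = trans (sym (from∘to u)) (trans (cong from eq) (from∘to v))
  where open _≅_ i

≅⇒size≡ : D ≅ E → n D ≡ n E
≅⇒size≡ i = cantor-schröder-bernstein (≅-to-injective i) (≅-to-injective (≅-sym i))

≅⇒adj≡ : (i : D ≅ E) → ∀ u v → adj E (_≅_.to i u) (_≅_.to i v) ≡ adj D u v
≅⇒adj≡ i u v = cong₂ _∨_ (preserve u v) (preserve v u)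
  where open _≅_ i

record _↪_ (H D : Digraph) : Set where
  field
    to          : Fin (n H) → Fin (n D)
    injective   : Injective _≡_ _≡_ to
    preserves   : ∀ u v → arc D (to u) (to v) ≡ arc H u v
open _↪_ public

≅⇒↪ : D ≅ E → D ↪ E
≅⇒↪ i = record { to = _≅_.to i ; injective = ≅-to-injective i ; preserves = _≅_.preserve i }

induced↪ : {f : Fin m → Fin (n D)} → Injective _≡_ _≡_ f → induced D f ↪ D
induced↪ f-inj = record { to = _ ; injective = f-inj ; preserves = λ _ _ → refl }

↪⇒≅induced : (e : H ↪ D) → H ≅ induced D (to e)
↪⇒≅induced e = record
  { to = λ u → u ; from = λ u → u ; from∘to = λ _ → refl ; to∘from = λ _ → refl
  ; preserve = λ u v → preserves e u v }

pullback : H ↪ D → MPartition M D → MPartition M H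
pullback {M = M} e P = record
  { part = part ∘ to e
  ; ok = λ u v u≢v → subst (Respects _) (preserves e u v) (ok (to e u) (to e v) (u≢v ∘ injective e)) }
  where open MPartition P

missed⇒< : {f : Fin m → Fin k} {w : Fin k} → Injective _≡_ _≡_ f → (∀ i → f i ≢ w) → m < k
missed⇒< {k = suc _} {f} f-inj f≢w =
  s≤s (injective⇒≤ (λ eq → f-inj (punchOut-injective (f≢w _ ∘ sym) (f≢w _ ∘ sym) eq)))

injective⇒surjective : {f : Fin m → Fin k} → Injective _≡_ _≡_ f → k ≤ m → ∀ w → ∃ λ i → f i ≡ w
injective⇒surjective {f = f} f-inj k≤m w with any? (λ i → f i ≟ w)
... | yes hit = hit
... | no miss = contradiction k≤m (<⇒≱ (missed⇒< f-inj (λ i eq → miss (i , eq))))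

injective⇒misses : {f : Fin m → Fin k} → Injective _≡_ _≡_ f → m < k → ∃ λ w → ∀ i → f i ≢ w
injective⇒misses {m} {k} {f} f-inj m<k with all? (λ w → any? (λ i → f i ≟ w))
... | yes onto = contradiction (injective⇒≤ preimage-injective) (<⇒≱ m<k)
  where
  preimage-injective : Injective _≡_ _≡_ (proj₁ ∘ onto)
  preimage-injective {v} {w} eq = trans (sym (proj₂ (onto v))) (trans (cong f eq) (proj₂ (onto w)))
... | no ¬onto with ¬∀⟶∃¬ k _ (λ w → any? (λ i → f i ≟ w)) ¬onto
...   | w , missed = w , λ i eq → missed (i , eq)

distinct₂⇒injective : {x y : Fin k} → x ≢ y → Injective _≡_ _≡_ (lookup (x ∷ y ∷ []))
distinct₂⇒injective x≢y {zero}     {zero}     _  = refl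
distinct₂⇒injective x≢y {zero}     {suc zero} eq = contradiction eq x≢y
distinct₂⇒injective x≢y {suc zero} {zero}     eq = contradiction (sym eq) x≢y
distinct₂⇒injective x≢y {suc zero} {suc zero} _  = refl

distinct₃⇒injective : {x y z : Fin k} → x ≢ y → x ≢ z → y ≢ z → Injective _≡_ _≡_ (lookup (x ∷ y ∷ z ∷ []))
distinct₃⇒injective x≢y x≢z y≢z {zero}           {zero}           _  = refl
distinct₃⇒injective x≢y x≢z y≢z {zero}           {suc zero}       eq = contradiction eq x≢y
distinct₃⇒injective x≢y x≢z y≢z {zero}           {suc (suc zero)} eq = contradiction eq x≢z
distinct₃⇒injective x≢y x≢z y≢z {suc zero}       {zero}           eq = contradiction (sym eq) x≢y
distinct₃⇒injective x≢y x≢z y≢z {suc zero}       {suc zero}       _  = refl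
distinct₃⇒injective x≢y x≢z y≢z {suc zero}       {suc (suc zero)} eq = contradiction eq y≢z
distinct₃⇒injective x≢y x≢z y≢z {suc (suc zero)} {zero}           eq = contradiction (sym eq) x≢z
distinct₃⇒injective x≢y x≢z y≢z {suc (suc zero)} {suc zero}       eq = contradiction (sym eq) y≢z
distinct₃⇒injective x≢y x≢z y≢z {suc (suc zero)} {suc (suc zero)} _  = refl

vectors : {A : Set} → List A → ∀ k → List (Vec A k)
vectors xs zero    = [] ∷ []
vectors xs (suc k) = cartesianProductWith _∷_ xs (vectors xs k)

∈-vectors : {A : Set} {xs : List A} → (∀ x → x ∈ xs) → (v : Vec A k) → v ∈ vectors xs k
∈-vectors all∈ []      = here refl
∈-vectors all∈ (x ∷ v) = ∈-cartesianProductWith⁺ _∷_ (all∈ x) (∈-vectors all∈ v)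

∃-function? : (P : (Fin k → Fin m) → Set) → (∀ {f g} → f ≗ g → P f → P g) →
              (∀ f → Dec (P f)) → Dec (∃ P)
∃-function? {k} {m} P resp P? =
  map′ (λ found → _ , proj₂ (Any.satisfied found))
       (λ (f , Pf) → lose (∈-vectors ∈-allFin (tabulate f)) (resp (sym ∘ lookup∘tabulate f) Pf))
       (Any.any? (P? ∘ lookup) (vectors (allFin m) k))

IsPartition : Matrix → (D : Digraph) → (Fin (n D) → Fin 2) → Set
IsPartition M D p = ∀ u v → u ≢ v → Respects (entry M (p u) (p v)) (arc D u v)

bit : Bool → Fin 2
bit false = # 0
bit true  = # 1

emptyPartition : ∀ {a l} → MPartition M (digraph zero a l)
emptyPartition = record { part = λ () ; ok = λ () }

respects? : ∀ e b → Dec (Respects e b)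
respects? e0 b = b Bool.≟ false
respects? e1 b = b Bool.≟ true
respects? e* b = yes tt

mpartition? : ∀ M D → Dec (MPartition M D)
mpartition? M D =
  map′ (λ (p , ok) → record { part = p ; ok = ok }) (λ P → MPartition.part P , MPartition.ok P)
       (∃-function? (IsPartition M D) resp (λ p → all? λ u → all? λ v → ¬? (u ≟ v) →-dec respects? _ _))
  where
  resp : ∀ {p q} → p ≗ q → IsPartition M D p → IsPartition M D q
  resp p≗q ok u v u≢v = subst₂ (λ i j → Respects (entry M i j) (arc D u v)) (p≗q u) (p≗q v) (ok u v u≢v)

injective? : (f : Fin m → Fin k) → Dec (Injective _≡_ _≡_ f)
injective? f = map′ (λ inj {x} {y} → inj x y) (λ inj x y → inj)
                    (all? λ x → all? λ y → (f x ≟ f y) →-dec (x ≟ y))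

_↪?_ : ∀ H D → Dec (H ↪ D)
H ↪? D =
  map′ (λ (f , inj , pres) → record { to = f ; injective = inj ; preserves = pres })
       (λ e → to e , (λ {x} {y} → injective e) , preserves e)
       (∃-function? IsEmbedding resp
          (λ f → injective? f ×-dec all? λ u → all? λ v → arc D (f u) (f v) Bool.≟ arc H u v))
  where
  IsEmbedding : (Fin (n H) → Fin (n D)) → Set
  IsEmbedding f = Injective _≡_ _≡_ f × (∀ u v → arc D (f u) (f v) ≡ arc H u v)
  resp : ∀ {f g} → f ≗ g → IsEmbedding f → IsEmbedding g
  resp f≗g (inj , pres) =
    (λ {x} {y} eq → inj (trans (f≗g x) (trans eq (sym (f≗g y))))) ,
    (λ u v → trans (sym (cong₂ (arc D) (f≗g u) (f≗g v))) (pres u v))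

-- Every obstruction in the theorem is twin-free, so the constructors embed₂, embed₃, embed₄ below
-- need no proof that the given vertices are distinct.
TwinFree : Digraph → Set
TwinFree H = ∀ i j → i ≢ j → ∃ λ k → arc H i k ≢ arc H j k ⊎ arc H k i ≢ arc H k j

twinFree? : ∀ H → Dec (TwinFree H)
twinFree? H = all? λ i → all? λ j → ¬? (i ≟ j) →-dec
  any? λ k → ¬? (arc H i k Bool.≟ arc H j k) ⊎-dec ¬? (arc H k i Bool.≟ arc H k j)

preserving⇒injective : TwinFree H → {f : Fin (n H) → Fin (n D)} →
                       (∀ u v → arc D (f u) (f v) ≡ arc H u v) → Injective _≡_ _≡_ f
preserving⇒injective {H} {D} twinFree {f} pres {i} {j} fi≡fj with i ≟ j
... | yes i≡j = i≡j
... | no i≢j with twinFree i j i≢j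
...   | k , inj₁ out≢ =
  contradiction (trans (sym (pres i k)) (trans (cong (λ x → arc D x (f k)) fi≡fj) (pres j k))) out≢
...   | k , inj₂ in≢  =
  contradiction (trans (sym (pres k i)) (trans (cong (arc D (f k)) fi≡fj) (pres k j))) in≢

module _ {D : Digraph} where
  private
    a = arc D

  embed : (H : Digraph) {_ : True (twinFree? H)} (xs : Vec (Fin (n D)) (n H)) →
          (∀ u v → a (lookup xs u) (lookup xs v) ≡ arc H u v) → H ↪ D
  embed H {twinFree} xs pres = record
    { to = lookup xs
    ; injective = preserving⇒injective {H = H} {D = D} (toWitness twinFree) pres
    ; preserves = pres }

  loop-preserved : (H : Digraph) (x : Fin (n D)) (i : Fin (n H)) → a x x ≡ arc H i i
  loop-preserved H x i = trans (loopless D x) (sym (loopless H i))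

  embed₂ : {h : Fin 2 → Fin 2 → Bool} {l : ∀ i → h i i ≡ false} {_ : True (twinFree? (digraph 2 h l))} →
           ∀ x y → a x y ≡ h (# 0) (# 1) → a y x ≡ h (# 1) (# 0) → digraph 2 h l ↪ D
  embed₂ {h} {l} {twinFree} x y xy yx = embed (digraph 2 h l) {twinFree} (x ∷ y ∷ []) pres
    where
    pres : ∀ i j → a (lookup (x ∷ y ∷ []) i) (lookup (x ∷ y ∷ []) j) ≡ h i j
    pres zero       zero       = loop-preserved (digraph 2 h l) x zero
    pres zero       (suc zero) = xy
    pres (suc zero) zero       = yx
    pres (suc zero) (suc zero) = loop-preserved (digraph 2 h l) y (suc zero)

  embed₃ : {h : Fin 3 → Fin 3 → Bool} {l : ∀ i → h i i ≡ false} {_ : True (twinFree? (digraph 3 h l))} →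
           ∀ x y z →
           a x y ≡ h (# 0) (# 1) → a x z ≡ h (# 0) (# 2) →
           a y x ≡ h (# 1) (# 0) → a y z ≡ h (# 1) (# 2) →
           a z x ≡ h (# 2) (# 0) → a z y ≡ h (# 2) (# 1) → digraph 3 h l ↪ D
  embed₃ {h} {l} {twinFree} x y z xy xz yx yz zx zy = embed (digraph 3 h l) {twinFree} xs pres
    where
    xs = x ∷ y ∷ z ∷ []
    pres : ∀ i j → a (lookup xs i) (lookup xs j) ≡ h i j
    pres zero             zero             = loop-preserved (digraph 3 h l) x zero
    pres zero             (suc zero)       = xy
    pres zero             (suc (suc zero)) = xz
    pres (suc zero)       zero             = yx
    pres (suc zero)       (suc zero)       = loop-preserved (digraph 3 h l) y (suc zero)
    pres (suc zero)       (suc (suc zero)) = yz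
    pres (suc (suc zero)) zero             = zx
    pres (suc (suc zero)) (suc zero)       = zy
    pres (suc (suc zero)) (suc (suc zero)) = loop-preserved (digraph 3 h l) z (suc (suc zero))

  embed₄ : {h : Fin 4 → Fin 4 → Bool} {l : ∀ i → h i i ≡ false} {_ : True (twinFree? (digraph 4 h l))} →
           ∀ x y z w →
           a x y ≡ h (# 0) (# 1) → a x z ≡ h (# 0) (# 2) → a x w ≡ h (# 0) (# 3) →
           a y x ≡ h (# 1) (# 0) → a y z ≡ h (# 1) (# 2) → a y w ≡ h (# 1) (# 3) →
           a z x ≡ h (# 2) (# 0) → a z y ≡ h (# 2) (# 1) → a z w ≡ h (# 2) (# 3) →
           a w x ≡ h (# 3) (# 0) → a w y ≡ h (# 3) (# 1) → a w z ≡ h (# 3) (# 2) → digraph 4 h l ↪ D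
  embed₄ {h} {l} {twinFree} x y z w xy xz xw yx yz yw zx zy zw wx wy wz =
    embed (digraph 4 h l) {twinFree} xs pres
    where
    xs = x ∷ y ∷ z ∷ w ∷ []
    pres : ∀ i j → a (lookup xs i) (lookup xs j) ≡ h i j
    pres zero                   zero                   = loop-preserved (digraph 4 h l) x zero
    pres zero                   (suc zero)             = xy
    pres zero                   (suc (suc zero))       = xz
    pres zero                   (suc (suc (suc zero))) = xw
    pres (suc zero)             zero                   = yx
    pres (suc zero)             (suc zero)             = loop-preserved (digraph 4 h l) y (suc zero)
    pres (suc zero)             (suc (suc zero))       = yz
    pres (suc zero)             (suc (suc (suc zero))) = yw
    pres (suc (suc zero))       zero                   = zx
    pres (suc (suc zero))       (suc zero)             = zy
    pres (suc (suc zero))       (suc (suc zero))       = loop-preserved (digraph 4 h l) z (suc (suc zero))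
    pres (suc (suc zero))       (suc (suc (suc zero))) = zw
    pres (suc (suc (suc zero))) zero                   = wx
    pres (suc (suc (suc zero))) (suc zero)             = wy
    pres (suc (suc (suc zero))) (suc (suc zero))       = wz
    pres (suc (suc (suc zero))) (suc (suc (suc zero))) = loop-preserved (digraph 4 h l) w (suc (suc (suc zero)))

deleteVertex : (D : Digraph) → Fin (n D) → Digraph
deleteVertex D@(digraph (suc _) _ _) w = induced D (punchIn w)

minObs-fromVertexDeletions : ¬ MPartition M D → (∀ w → MPartition M (deleteVertex D w)) → MinObs M D
minObs-fromVertexDeletions {D = digraph zero _ _} ¬P _ = ¬P , λ _ _ _ ()
minObs-fromVertexDeletions {M = M} {D = D@(digraph (suc _) a _)} ¬P P-w = ¬P , proper
  where
  proper : ∀ m (f : Fin m → Fin (n D)) → Injective _≡_ _≡_ f → m < n D → MPartition M (induced D f)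
  proper m f f-inj m<n with injective⇒misses f-inj m<n
  ... | w , f≢w = pullback avoiding-w (P-w w)
    where
    avoiding-w : induced D f ↪ deleteVertex D w
    avoiding-w = record
      { to = λ i → punchOut (f≢w i ∘ sym)
      ; injective = λ {i} {j} eq → f-inj (punchOut-injective (f≢w i ∘ sym) (f≢w j ∘ sym) eq)
      ; preserves = λ i j → cong₂ a (punchIn-punchOut _) (punchIn-punchOut _) }

minObs-by-decision : ∀ M H →
  {_ : True (¬? (mpartition? M H) ×-dec all? (λ w → mpartition? M (deleteVertex H w)))} → MinObs M H
minObs-by-decision M H {verified} = minObs-fromVertexDeletions ¬P P-w
  where
  ¬P = proj₁ (toWitness verified)
  P-w = proj₂ (toWitness verified)

minObs-resp-≅ : D ≅ E → MinObs M E → MinObs M D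
minObs-resp-≅ i (¬P , proper) =
  ¬P ∘ pullback (≅⇒↪ (≅-sym i)) ,
  λ m f f-inj m<n → pullback
    (record { to = λ u → u ; injective = λ eq → eq ; preserves = λ u v → _≅_.preserve i (f u) (f v) })
    (proper m (_≅_.to i ∘ f) (f-inj ∘ ≅-to-injective i) (subst (m <_) (≅⇒size≡ i) m<n))

minObs-containing⇒≅ : MinObs M D → H ↪ D → ¬ MPartition M H → D ≅ H
minObs-containing⇒≅ {D = D} {H = H} (_ , proper) e ¬PH = record
  { to = proj₁ ∘ onto ; from = to e
  ; from∘to = proj₂ ∘ onto
  ; to∘from = λ v → injective e (proj₂ (onto (to e v)))
  ; preserve = λ u v → trans (sym (preserves e _ _)) (cong₂ (arc D) (proj₂ (onto u)) (proj₂ (onto v))) }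
  where
  spanning : n D ≤ n H
  spanning with n H <? n D
  ... | yes smaller = contradiction (pullback (≅⇒↪ (↪⇒≅induced e)) (proper _ (to e) (injective e) smaller)) ¬PH
  ... | no ¬smaller = ≮⇒≥ ¬smaller
  onto = injective⇒surjective (injective e) spanning

characterisation : (C : Digraph → Set) → (∀ {D E} → D ≅ E → C E → C D) → (∀ {H} → C H → MinObs M H) →
                   (∀ D → ¬ MPartition M D → ∃ λ H → C H × H ↪ D) →
                   ∀ D → MinObs M D ⟺ C D
characterisation {M = M} C C-resp-≅ C⇒minObs contains D = sound , C⇒minObs
  where
  sound : MinObs M D → C D
  sound minObs with contains D (proj₁ minObs)
  ... | H , CH , e = C-resp-≅ (minObs-containing⇒≅ minObs e (proj₁ (C⇒minObs CH))) CH

Free : List Digraph → Digraph → Set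
Free Hs D = All (λ H → ¬ H ↪ D) Hs

characterisation-byFreeness : (Hs : List Digraph) → All (MinObs M) Hs →
                              (∀ D → Free Hs D → MPartition M D) →
                              ∀ D → MinObs M D ⟺ Any (D ≅_) Hs
characterisation-byFreeness {M = M} Hs minObs partition =
  characterisation (λ D → Any (D ≅_) Hs) (λ i → Any.map (≅-trans i)) member⇒minObs contains
  where
  member⇒minObs : Any (H ≅_) Hs → MinObs M H
  member⇒minObs H≅ with find H≅
  ... | _ , H'∈Hs , i = minObs-resp-≅ i (All.lookup minObs H'∈Hs)
  contains : ∀ D → ¬ MPartition M D → ∃ λ H → Any (H ≅_) Hs × H ↪ D
  contains D ¬P with Any.any? (_↪? D) Hs
  ... | yes found with find found
  ...   | H , H∈Hs , e = H , Any.map (λ { refl → ≅-refl }) H∈Hs , e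
  contains D ¬P | no ¬found = contradiction (partition D (¬Any⇒All¬ Hs ¬found)) ¬P

Alternatives : {A : Set} → (A → Set) → List A → Set
Alternatives P []           = ⊥
Alternatives P (x ∷ [])     = P x
Alternatives P (x ∷ y ∷ ys) = P x ⊎ Alternatives P (y ∷ ys)

any⟺alternatives : {A : Set} {P : A → Set} (xs : List A) → Any P xs ⟺ Alternatives P xs
any⟺alternatives xs = to-alt xs , from-alt xs
  where
  to-alt : ∀ xs → Any _ xs → Alternatives _ xs
  to-alt (x ∷ [])     (here p)  = p
  to-alt (x ∷ y ∷ ys) (here p)  = inj₁ p
  to-alt (x ∷ y ∷ ys) (there p) = inj₂ (to-alt (y ∷ ys) p)
  from-alt : ∀ xs → Alternatives _ xs → Any _ xs
  from-alt (x ∷ [])     p        = here p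
  from-alt (x ∷ y ∷ ys) (inj₁ p) = here p
  from-alt (x ∷ y ∷ ys) (inj₂ p) = there (from-alt (y ∷ ys) p)

-- The matrices M₂, M₄ and M₆

module _ {D : Digraph} where
  private
    a = arc D

  ¬digon⇒asymmetric : ¬ digon ↪ D → ∀ {u v} → a u v ≡ true → a v u ≡ false
  ¬digon⇒asymmetric ¬digon {u} {v} uv = ¬-not λ vu → ¬digon (embed₂ u v uv vu)

  ¬asymArc⇒symmetric : ¬ asymArc ↪ D → ∀ u v → a u v ≡ a v u
  ¬asymArc⇒symmetric ¬asym u v with a u v in uv | a v u in vu
  ... | true  | true  = refl
  ... | false | false = refl
  ... | true  | false = contradiction (embed₂ u v uv vu) ¬asym
  ... | false | true  = contradiction (embed₂ v u vu uv) ¬asym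

  no-twoPaths : ¬ digon ↪ D → ¬ P3 ↪ D → ¬ TT3 ↪ D → ¬ C3 ↪ D →
                ∀ {x y z} → a x y ≡ true → a y z ≡ true → ⊥
  no-twoPaths ¬digon ¬P3 ¬TT3 ¬C3 xy yz = closing xy yz (asymmetric xy) (asymmetric yz)
    where
    asymmetric = ¬digon⇒asymmetric ¬digon
    closing : ∀ {x y z} → a x y ≡ true → a y z ≡ true → a y x ≡ false → a z y ≡ false → ⊥
    closing {x} {y} {z} xy yz yx zy with a x z in xz | a z x in zx
    ... | false | false = ¬P3  (embed₃ x y z xy xz yx yz zx zy)
    ... | true  | false = ¬TT3 (embed₃ x y z xy xz yx yz zx zy)
    ... | false | true  = ¬C3  (embed₃ x y z xy xz yx yz zx zy)
    ... | true  | true  = ¬digon (embed₂ x z xz zx)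

M6-obstructions : List Digraph
M6-obstructions = asymArc ∷ digon ∷ []

M6-partition : ∀ D → Free M6-obstructions D → MPartition M6 D
M6-partition D (¬asym ∷ ¬digon ∷ []) = record
  { part = λ _ → zero
  ; ok = λ u v _ → ¬-not λ uv → ¬digon (embed₂ u v uv (trans (¬asymArc⇒symmetric ¬asym v u) uv)) }

M6-characterisation : ∀ D → MinObs M6 D ⟺ Any (D ≅_) M6-obstructions
M6-characterisation = characterisation-byFreeness M6-obstructions
  (minObs-by-decision M6 asymArc ∷ minObs-by-decision M6 digon ∷ [])
  M6-partition

hasOutNeighbour? : ∀ D u → Dec (∃ λ w → arc D u w ≡ true)
hasOutNeighbour? D u = any? λ w → arc D u w Bool.≟ true

M2-obstructions : List Digraph
M2-obstructions = digon ∷ P3 ∷ TT3 ∷ C3 ∷ []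

M2-partition : ∀ D → Free M2-obstructions D → MPartition M2 D
M2-partition D (¬digon ∷ ¬P3 ∷ ¬TT3 ∷ ¬C3 ∷ []) = record { part = bit ∘ does ∘ hasOutNeighbour? D ; ok = ok }
  where
  ok : IsPartition M2 D (bit ∘ does ∘ hasOutNeighbour? D)
  ok u v _ with hasOutNeighbour? D u | hasOutNeighbour? D v
  ... | yes _     | yes (_ , vw) = ¬-not λ uv → no-twoPaths ¬digon ¬P3 ¬TT3 ¬C3 uv vw
  ... | yes _     | no _         = tt
  ... | no ¬out-u | yes _        = ¬-not λ uv → ¬out-u (v , uv)
  ... | no ¬out-u | no _         = ¬-not λ uv → ¬out-u (v , uv)

M2-characterisation : ∀ D → MinObs M2 D ⟺ Any (D ≅_) M2-obstructions
M2-characterisation = characterisation-byFreeness M2-obstructions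
  (minObs-by-decision M2 digon ∷ minObs-by-decision M2 P3 ∷ minObs-by-decision M2 TT3 ∷
   minObs-by-decision M2 C3 ∷ [])
  M2-partition

M4-obstructions : List Digraph
M4-obstructions = digon ∷ TT3 ∷ C3 ∷ arcK1 ∷ P3 ∷ []

M4-partition : ∀ D → Free M4-obstructions D → MPartition M4 D
M4-partition D (¬digon ∷ ¬TT3 ∷ ¬C3 ∷ ¬arcK1 ∷ ¬P3 ∷ []) =
  record { part = bit ∘ does ∘ hasOutNeighbour? D ; ok = ok }
  where
  no-twoPaths′ = no-twoPaths ¬digon ¬P3 ¬TT3 ¬C3
  ok : IsPartition M4 D (bit ∘ does ∘ hasOutNeighbour? D)
  ok u v _ with hasOutNeighbour? D u | hasOutNeighbour? D v
  ... | yes _        | yes (_ , vw) = ¬-not λ uv → no-twoPaths′ uv vw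
  ... | yes (w , uw) | no ¬out-v    = ¬-not λ uv → ¬arcK1 (embed₃ u w v
        uw uv (¬digon⇒asymmetric ¬digon uw) (¬-not λ wv → no-twoPaths′ uw wv)
        (¬-not λ vu → ¬out-v (u , vu)) (¬-not λ vw → ¬out-v (w , vw)))
  ... | no ¬out-u    | yes _        = ¬-not λ uv → ¬out-u (v , uv)
  ... | no ¬out-u    | no _         = ¬-not λ uv → ¬out-u (v , uv)

M4-characterisation : ∀ D → MinObs M4 D ⟺ Any (D ≅_) M4-obstructions
M4-characterisation = characterisation-byFreeness M4-obstructions
  (minObs-by-decision M4 digon ∷ minObs-by-decision M4 TT3 ∷ minObs-by-decision M4 C3 ∷
   minObs-by-decision M4 arcK1 ∷ minObs-by-decision M4 P3 ∷ [])
  M4-partition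

-- Complete bipartite underlying graphs and the matrix M₅

adj-sym : ∀ D u v → adj D u v ≡ adj D v u
adj-sym D u v = ∨-comm (arc D u v) (arc D v u)

adj-irreflexive : ∀ D {u v} → adj D u v ≡ true → u ≢ v
adj-irreflexive D {u} uv refl with trans (sym uv) (cong₂ _∨_ (loopless D u) (loopless D u))
... | ()

nonadjacent⇒no-arc : ∀ D {u v} → adj D u v ≡ false → arc D u v ≡ false
nonadjacent⇒no-arc D {u} {v} uv with arc D u v | uv
... | false | _ = refl

Triangle : Digraph → Set
Triangle D = ∃ λ x → ∃ λ y → ∃ λ z → adj D x y ≡ true × adj D y z ≡ true × adj D x z ≡ true

triangle? : ∀ D → Dec (Triangle D)
triangle? D = any? λ x → any? λ y → any? λ z →
  (adj D x y Bool.≟ true) ×-dec (adj D y z Bool.≟ true) ×-dec (adj D x z Bool.≟ true)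

EdgeAndNonNeighbour : Digraph → Set
EdgeAndNonNeighbour D =
  ∃ λ x → ∃ λ y → ∃ λ z → adj D x y ≡ true × adj D x z ≡ false × adj D y z ≡ false

edgeAndNonNeighbour? : ∀ D → Dec (EdgeAndNonNeighbour D)
edgeAndNonNeighbour? D = any? λ x → any? λ y → any? λ z →
  (adj D x y Bool.≟ true) ×-dec (adj D x z Bool.≟ false) ×-dec (adj D y z Bool.≟ false)

record CompleteBipartition (D : Digraph) : Set where
  field
    colour             : Fin (n D) → Bool
    same⇒nonadjacent   : ∀ {u v} → colour u ≡ colour v → adj D u v ≡ false
    different⇒adjacent : ∀ {u v} → colour u ≢ colour v → adj D u v ≡ true

  same⇒no-arc : ∀ {u v} → colour u ≡ colour v → arc D u v ≡ false
  same⇒no-arc = nonadjacent⇒no-arc D ∘ same⇒nonadjacent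

-- Colour by adjacency to r: an edge between two neighbours of r closes a triangle, and an edge
-- between two non-neighbours or a non-edge across the classes is an induced K₁ + K₂.
completeBipartition : ∀ {D} → Fin (n D) → ¬ Triangle D → ¬ EdgeAndNonNeighbour D → CompleteBipartition D
completeBipartition {D} r ¬triangle ¬edgeAndNonNeighbour = record
  { colour = λ u → adj D u r ; same⇒nonadjacent = same ; different⇒adjacent = different }
  where
  same : ∀ {u v} → adj D u r ≡ adj D v r → adj D u v ≡ false
  same {u} {v} ur≡vr with adj D u r in ur | adj D v r in vr
  ... | true  | true  = ¬-not λ uv → ¬triangle (u , v , r , uv , vr , ur)
  ... | false | false = ¬-not λ uv → ¬edgeAndNonNeighbour (u , v , r , uv , ur , vr)
  different : ∀ {u v} → adj D u r ≢ adj D v r → adj D u v ≡ true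
  different {u} {v} ur≢vr with adj D u r in ur | adj D v r in vr
  ... | true  | true  = contradiction refl ur≢vr
  ... | false | false = contradiction refl ur≢vr
  ... | true  | false = ¬-not λ uv → ¬edgeAndNonNeighbour (u , r , v , ur , uv , trans (adj-sym D r v) vr)
  ... | false | true  = ¬-not λ uv →
    ¬edgeAndNonNeighbour (v , r , u , vr , trans (adj-sym D v u) uv , trans (adj-sym D r u) ur)

flipColours : CompleteBipartition D → CompleteBipartition D
flipColours B = record
  { colour = not ∘ colour
  ; same⇒nonadjacent = same⇒nonadjacent ∘ Bool.not-injective
  ; different⇒adjacent = λ u≢v → different⇒adjacent (u≢v ∘ cong not) }
  where open CompleteBipartition B

module _ {D : Digraph} (¬asym : ¬ asymArc ↪ D) where
  private
    symmetric = ¬asymArc⇒symmetric ¬asym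

  symmetric⇒arc≡adj : ∀ u v → arc D u v ≡ adj D u v
  symmetric⇒arc≡adj u v = trans (sym (∨-idem (arc D u v))) (cong (arc D u v ∨_) (symmetric u v))

  arc-from-adj : ∀ {u v b} → adj D u v ≡ b → arc D u v ≡ b
  arc-from-adj {u} {v} uv = trans (symmetric⇒arc≡adj u v) uv

  reverse-arc-from-adj : ∀ {u v b} → adj D u v ≡ b → arc D v u ≡ b
  reverse-arc-from-adj {u} {v} uv = arc-from-adj (trans (adj-sym D v u) uv)

  symmetric-triangle : ¬ biK3 ↪ D → ¬ Triangle D
  symmetric-triangle ¬biK3 (x , y , z , xy , yz , xz) = ¬biK3 (embed₃ x y z
    (arc-from-adj xy) (arc-from-adj xz) (reverse-arc-from-adj xy)
    (arc-from-adj yz) (reverse-arc-from-adj xz) (reverse-arc-from-adj yz))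

  symmetric-edgeAndNonNeighbour : ¬ biK1K2 ↪ D → ¬ EdgeAndNonNeighbour D
  symmetric-edgeAndNonNeighbour ¬biK1K2 (x , y , z , xy , xz , yz) = ¬biK1K2 (embed₃ x y z
    (arc-from-adj xy) (arc-from-adj xz) (reverse-arc-from-adj xy)
    (arc-from-adj yz) (reverse-arc-from-adj xz) (reverse-arc-from-adj yz))

M5-obstructions : List Digraph
M5-obstructions = asymArc ∷ biK3 ∷ biK1K2 ∷ []

M5-partition : ∀ D → Free M5-obstructions D → MPartition M5 D
M5-partition (digraph zero _ _) _ = emptyPartition
M5-partition D@(digraph (suc _) _ _) (¬asym ∷ ¬biK3 ∷ ¬biK1K2 ∷ []) =
  record { part = bit ∘ colour ; ok = ok }
  where
  open CompleteBipartition
    (completeBipartition {D} zero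
      (symmetric-triangle ¬asym ¬biK3) (symmetric-edgeAndNonNeighbour ¬asym ¬biK1K2))
  ok : IsPartition M5 D (bit ∘ colour)
  ok u v _ with colour u in cu | colour v in cv
  ... | false | false = same⇒no-arc (trans cu (sym cv))
  ... | true  | true  = same⇒no-arc (trans cu (sym cv))
  ... | false | true  = arc-from-adj ¬asym (different⇒adjacent λ c → not-¬ cu (trans c cv))
  ... | true  | false = arc-from-adj ¬asym (different⇒adjacent λ c → not-¬ cu (trans c cv))

M5-characterisation : ∀ D → MinObs M5 D ⟺ Any (D ≅_) M5-obstructions
M5-characterisation = characterisation-byFreeness M5-obstructions
  (minObs-by-decision M5 asymArc ∷ minObs-by-decision M5 biK3 ∷ minObs-by-decision M5 biK1K2 ∷ [])
  M5-partition

-- The matrix M₃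

reverse-of-missing : ∀ D {x y} → adj D x y ≡ true → arc D x y ≡ false → arc D y x ≡ true
reverse-of-missing D {x} {y} xy x↛y = subst (λ b → b ∨ arc D y x ≡ true) x↛y xy

data Edge (D : Digraph) (x y : Fin (n D)) : Set where
  forward  : arc D x y ≡ true  → arc D y x ≡ false → Edge D x y
  backward : arc D x y ≡ false → arc D y x ≡ true  → Edge D x y
  both     : arc D x y ≡ true  → arc D y x ≡ true  → Edge D x y

edge : ∀ D {x y} → adj D x y ≡ true → Edge D x y
edge D {x} {y} xy with arc D x y in p | arc D y x in q | xy
... | true  | true  | _  = both p q
... | true  | false | _  = forward p q
... | false | true  | _  = backward p q
... | false | false | ()

module _ {D : Digraph} (B : CompleteBipartition D) where
  open CompleteBipartition B

  private
    alike : ∀ {x y b} → colour x ≡ b → colour y ≡ b → arc D x y ≡ false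
    alike cx cy = same⇒no-arc (trans cx (sym cy))

    across : ∀ {x y b} → colour x ≡ b → colour y ≡ not b → adj D x y ≡ true
    across cx cy = different⇒adjacent λ c → not-¬ cx (trans c cy)

  oriented-partition : (∀ {u v} → colour u ≡ false → colour v ≡ true → arc D u v ≡ true) → MPartition M3 D
  oriented-partition oriented = record { part = bit ∘ colour ; ok = ok }
    where
    ok : IsPartition M3 D (bit ∘ colour)
    ok u v _ with colour u in cu | colour v in cv
    ... | false | false = alike cu cv
    ... | true  | true  = alike cu cv
    ... | false | true  = oriented cu cv
    ... | true  | false = tt

  -- Given a₀ ↛ b₀ and u ↛ v, an edge a₀u or vb₀ that is not a digon completes one of the reversed
  -- arcs b₀ → a₀, v → u to an induced P3; if both are digons, v u a₀ b₀ induce C4mixed.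
  reverse-oriented : ¬ P3 ↪ D → ¬ C4mixed ↪ D →
                     ∀ {a₀ b₀} → colour a₀ ≡ false → colour b₀ ≡ true → arc D a₀ b₀ ≡ false →
                     ∀ {u v} → colour u ≡ true → colour v ≡ false → arc D u v ≡ true
  reverse-oriented ¬P3 ¬C4 {a₀} {b₀} ca₀ cb₀ a₀b₀ {u} {v} cu cv =
    ¬-not λ uv → obstruction uv (reverse-of-missing D (across cu cv) uv)
    where
    b₀a₀ = reverse-of-missing D (across ca₀ cb₀) a₀b₀
    obstruction : arc D u v ≡ false → arc D v u ≡ true → ⊥
    obstruction uv vu with edge D (across ca₀ cu) | edge D (across cv cb₀)
    ... | forward a₀u ua₀  | _ = ¬P3 (embed₃ b₀ a₀ u b₀a₀ (alike cb₀ cu) a₀b₀ a₀u (alike cu cb₀) ua₀)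
    ... | backward a₀u ua₀ | _ = ¬P3 (embed₃ v u a₀ vu (alike cv ca₀) uv ua₀ (alike ca₀ cv) a₀u)
    ... | both _ _ | forward vb₀ b₀v  = ¬P3 (embed₃ v b₀ a₀ vb₀ (alike cv ca₀) b₀v b₀a₀ (alike ca₀ cv) a₀b₀)
    ... | both _ _ | backward vb₀ b₀v = ¬P3 (embed₃ b₀ v u b₀v (alike cb₀ cu) vb₀ vu (alike cu cb₀) uv)
    ... | both a₀u ua₀ | both vb₀ b₀v = ¬C4 (embed₄ v u a₀ b₀
          vu (alike cv ca₀) vb₀ uv ua₀ (alike cu cb₀) (alike ca₀ cv) a₀u a₀b₀ b₀v (alike cb₀ cu) b₀a₀)

M3-partition : ∀ D → ¬ Triangle D → ¬ EdgeAndNonNeighbour D → ¬ P3 ↪ D → ¬ C4mixed ↪ D → MPartition M3 D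
M3-partition (digraph zero _ _) _ _ _ _ = emptyPartition
M3-partition D@(digraph (suc _) _ _) ¬triangle ¬edgeAndNonNeighbour ¬P3 ¬C4 = orient misoriented?
  where
  B = completeBipartition {D} zero ¬triangle ¬edgeAndNonNeighbour
  open CompleteBipartition B
  Misoriented = ∃ λ u → ∃ λ v → colour u ≡ false × colour v ≡ true × arc D u v ≡ false
  misoriented? : Dec Misoriented
  misoriented? = any? λ u → any? λ v →
    (colour u Bool.≟ false) ×-dec (colour v Bool.≟ true) ×-dec (arc D u v Bool.≟ false)
  orient : Dec Misoriented → MPartition M3 D
  orient (no ¬misoriented) = oriented-partition B λ cu cv → ¬-not λ uv → ¬misoriented (_ , _ , cu , cv , uv)
  orient (yes (_ , _ , ca₀ , cb₀ , a₀b₀)) = oriented-partition (flipColours B) λ cu cv →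
    reverse-oriented B ¬P3 ¬C4 ca₀ cb₀ a₀b₀ (Bool.not-injective cu) (Bool.not-injective cv)

module _ {D : Digraph} (P : MPartition M3 D) where
  open MPartition P

  sameSide⇒no-arc : ∀ {u v} → u ≢ v → part u ≡ part v → arc D u v ≡ false
  sameSide⇒no-arc {u} {v} u≢v same with part u | part v | ok u v u≢v | same
  ... | zero     | .zero       | no-arc | refl = no-arc
  ... | suc zero | .(suc zero) | no-arc | refl = no-arc

  sameSide⇒nonadjacent : ∀ {u v} → u ≢ v → part u ≡ part v → adj D u v ≡ false
  sameSide⇒nonadjacent u≢v same = cong₂ _∨_ (sameSide⇒no-arc u≢v same) (sameSide⇒no-arc (u≢v ∘ sym) (sym same))

  differentSides⇒adjacent : ∀ {u v} → u ≢ v → part u ≢ part v → adj D u v ≡ true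
  differentSides⇒adjacent {u} {v} u≢v different with part u | part v | ok u v u≢v | ok v u (u≢v ∘ sym)
  ... | zero     | zero     | _  | _  = contradiction refl different
  ... | suc zero | suc zero | _  | _  = contradiction refl different
  ... | zero     | suc zero | uv | _  = cong (_∨ arc D v u) uv
  ... | suc zero | zero     | _  | vu = trans (cong (arc D u v ∨_) vu) (∨-zeroʳ (arc D u v))

underlyingK3⇒¬M3-partition : UnderlyingK3 D → ¬ MPartition M3 D
underlyingK3⇒¬M3-partition (three , complete) P
  with pigeonhole (subst (2 <_) (sym three) (n<1+n 2)) (MPartition.part P)
... | i , j , i<j , same =
  contradiction (sameSide⇒nonadjacent P (<⇒≢ i<j) same) (not-¬ (complete i j (<⇒≢ i<j)))

underlyingK1K2⇒¬M3-partition : UnderlyingK1K2 D → ¬ MPartition M3 D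
underlyingK1K2⇒¬M3-partition {D} (three , x , y , x≢y , xy , only) P =
  thirdVertex (injective⇒misses (distinct₂⇒injective x≢y) (subst (2 <_) (sym three) (n<1+n 2)))
  where
  open MPartition P
  x∼y : part x ≢ part y
  x∼y same = contradiction (sameSide⇒nonadjacent P x≢y same) (not-¬ xy)
  isolated : ∀ {z w} → (∀ i → lookup (x ∷ y ∷ []) i ≢ z) → adj D z w ≡ true → ⊥
  isolated z∉xy zw with only _ _ zw
  ... | inj₁ (z≡x , _) = z∉xy (# 0) (sym z≡x)
  ... | inj₂ (z≡y , _) = z∉xy (# 1) (sym z≡y)
  thirdVertex : (∃ λ z → ∀ i → lookup (x ∷ y ∷ []) i ≢ z) → ⊥
  thirdVertex (z , z∉xy) with part z ≟ part y
  ... | yes zy = isolated z∉xy (differentSides⇒adjacent P (z∉xy (# 0) ∘ sym) λ zx → x∼y (trans (sym zx) zy))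
  ... | no ¬zy = isolated z∉xy (differentSides⇒adjacent P (z∉xy (# 1) ∘ sym) ¬zy)

module _ (D : Digraph) where
  private
    ∼sym = adj-sym D

  triangle-injective : ((x , y , z , _) : Triangle D) → Injective _≡_ _≡_ (lookup (x ∷ y ∷ z ∷ []))
  triangle-injective (_ , _ , _ , xy , yz , xz) =
    distinct₃⇒injective (adj-irreflexive D xy) (adj-irreflexive D xz) (adj-irreflexive D yz)

  triangle-induces-K3 : ((x , y , z , _) : Triangle D) → UnderlyingK3 (induced D (lookup (x ∷ y ∷ z ∷ [])))
  triangle-induces-K3 (x , y , z , xy , yz , xz) = refl , complete
    where
    complete : ∀ u v → u ≢ v → adj D (lookup (x ∷ y ∷ z ∷ []) u) (lookup (x ∷ y ∷ z ∷ []) v) ≡ true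
    complete zero             zero             u≢v = contradiction refl u≢v
    complete zero             (suc zero)       _   = xy
    complete zero             (suc (suc zero)) _   = xz
    complete (suc zero)       zero             _   = trans (∼sym y x) xy
    complete (suc zero)       (suc zero)       u≢v = contradiction refl u≢v
    complete (suc zero)       (suc (suc zero)) _   = yz
    complete (suc (suc zero)) zero             _   = trans (∼sym z x) xz
    complete (suc (suc zero)) (suc zero)       _   = trans (∼sym z y) yz
    complete (suc (suc zero)) (suc (suc zero)) u≢v = contradiction refl u≢v

  edgeAndNonNeighbour-injective : ((x , y , z , _) : EdgeAndNonNeighbour D) →
                                  Injective _≡_ _≡_ (lookup (x ∷ y ∷ z ∷ []))
  edgeAndNonNeighbour-injective (x , y , z , xy , xz , yz) = distinct₃⇒injective (adj-irreflexive D xy) x≢z y≢z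
    where
    x≢z : x ≢ z
    x≢z refl = contradiction (trans (∼sym y x) xy) (not-¬ yz)
    y≢z : y ≢ z
    y≢z refl = contradiction xy (not-¬ xz)

  edgeAndNonNeighbour-induces-K1K2 : ((x , y , z , _) : EdgeAndNonNeighbour D) →
                                     UnderlyingK1K2 (induced D (lookup (x ∷ y ∷ z ∷ [])))
  edgeAndNonNeighbour-induces-K1K2 (x , y , z , xy , xz , yz) = refl , # 0 , # 1 , (λ ()) , xy , only
    where
    only : ∀ u v → adj D (lookup (x ∷ y ∷ z ∷ []) u) (lookup (x ∷ y ∷ z ∷ []) v) ≡ true →
           (u ≡ # 0 × v ≡ # 1) ⊎ (u ≡ # 1 × v ≡ # 0)
    only zero             zero             uv = contradiction refl (adj-irreflexive D uv)
    only zero             (suc zero)       _  = inj₁ (refl , refl)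
    only zero             (suc (suc zero)) uv = contradiction uv (not-¬ xz)
    only (suc zero)       zero             _  = inj₂ (refl , refl)
    only (suc zero)       (suc zero)       uv = contradiction refl (adj-irreflexive D uv)
    only (suc zero)       (suc (suc zero)) uv = contradiction uv (not-¬ yz)
    only (suc (suc zero)) zero             uv = contradiction (trans (∼sym x z) uv) (not-¬ xz)
    only (suc (suc zero)) (suc zero)       uv = contradiction (trans (∼sym y z) uv) (not-¬ yz)
    only (suc (suc zero)) (suc (suc zero)) uv = contradiction refl (adj-irreflexive D uv)

M3-partition-small : ∀ D → n D ≤ 2 → MPartition M3 D
M3-partition-small D n≤2 = M3-partition D
  (λ t → tooSmall (injective⇒≤ (triangle-injective D t)))
  (λ e → tooSmall (injective⇒≤ (edgeAndNonNeighbour-injective D e)))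
  (λ e → tooSmall (injective⇒≤ (injective e)))
  (λ e → tooSmall (<⇒≤ (injective⇒≤ (injective e))))
  where
  tooSmall : 3 ≤ n D → ⊥
  tooSmall 3≤n = <⇒≱ 3≤n n≤2

threeVertices⇒M3-minObs : n D ≡ 3 → ¬ MPartition M3 D → MinObs M3 D
threeVertices⇒M3-minObs {D} three ¬P =
  ¬P , λ m f _ m<n → M3-partition-small (induced D f) (≤-pred (subst (m <_) three m<n))

underlyingK3-resp-≅ : D ≅ E → UnderlyingK3 E → UnderlyingK3 D
underlyingK3-resp-≅ i (three , complete) =
  trans (≅⇒size≡ i) three ,
  λ u v u≢v → trans (sym (≅⇒adj≡ i u v)) (complete _ _ (u≢v ∘ ≅-to-injective i))

underlyingK1K2-resp-≅ : D ≅ E → UnderlyingK1K2 E → UnderlyingK1K2 D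
underlyingK1K2-resp-≅ {D} {E} i (three , x , y , x≢y , xy , only) =
  trans (≅⇒size≡ i) three , from x , from y , x≢y ∘ ≅-to-injective (≅-sym i) ,
  trans (sym (≅⇒adj≡ i (from x) (from y))) (trans (cong₂ (adj E) (to∘from x) (to∘from y)) xy) , only′
  where
  open _≅_ i using (from; from∘to; to∘from) renaming (to to image)
  back : ∀ {u w} → image u ≡ w → u ≡ from w
  back {u} eq = trans (sym (from∘to u)) (cong from eq)
  only′ : ∀ u v → adj D u v ≡ true → (u ≡ from x × v ≡ from y) ⊎ (u ≡ from y × v ≡ from x)
  only′ u v uv with only (image u) (image v) (trans (≅⇒adj≡ i u v) uv)
  ... | inj₁ (ux , vy) = inj₁ (back ux , back vy)
  ... | inj₂ (uy , vx) = inj₂ (back uy , back vx)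

M3-Obstruction : Digraph → Set
M3-Obstruction D = UnderlyingK3 D ⊎ UnderlyingK1K2 D ⊎ D ≅ P3 ⊎ D ≅ C4mixed

M3-characterisation : ∀ D → MinObs M3 D ⟺ M3-Obstruction D
M3-characterisation = characterisation M3-Obstruction resp-≅ minObs contains
  where
  resp-≅ : D ≅ E → M3-Obstruction E → M3-Obstruction D
  resp-≅ i (inj₁ k3)                = inj₁ (underlyingK3-resp-≅ i k3)
  resp-≅ i (inj₂ (inj₁ k1k2))       = inj₂ (inj₁ (underlyingK1K2-resp-≅ i k1k2))
  resp-≅ i (inj₂ (inj₂ (inj₁ j)))   = inj₂ (inj₂ (inj₁ (≅-trans i j)))
  resp-≅ i (inj₂ (inj₂ (inj₂ j)))   = inj₂ (inj₂ (inj₂ (≅-trans i j)))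
  minObs : M3-Obstruction H → MinObs M3 H
  minObs (inj₁ k3)                = threeVertices⇒M3-minObs (proj₁ k3) (underlyingK3⇒¬M3-partition k3)
  minObs (inj₂ (inj₁ k1k2))       = threeVertices⇒M3-minObs (proj₁ k1k2) (underlyingK1K2⇒¬M3-partition k1k2)
  minObs (inj₂ (inj₂ (inj₁ i)))   = minObs-resp-≅ i (minObs-by-decision M3 P3)
  minObs (inj₂ (inj₂ (inj₂ i)))   = minObs-resp-≅ i (minObs-by-decision M3 C4mixed)
  contains : ∀ D → ¬ MPartition M3 D → ∃ λ H → M3-Obstruction H × H ↪ D
  contains D ¬P with triangle? D | edgeAndNonNeighbour? D | P3 ↪? D | C4mixed ↪? D
  ... | yes t | _     | _     | _     = _ , inj₁ (triangle-induces-K3 D t) , induced↪ (triangle-injective D t)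
  ... | no _  | yes e | _     | _     =
    _ , inj₂ (inj₁ (edgeAndNonNeighbour-induces-K1K2 D e)) , induced↪ (edgeAndNonNeighbour-injective D e)
  ... | no _  | no _  | yes e | _     = P3 , inj₂ (inj₂ (inj₁ ≅-refl)) , e
  ... | no _  | no _  | no _  | yes e = C4mixed , inj₂ (inj₂ (inj₂ ≅-refl)) , e
  ... | no ¬t | no ¬e | no ¬p | no ¬c = contradiction (M3-partition D ¬t ¬e ¬p ¬c) ¬P

-- Transposition and finiteness

transpose : Matrix → Matrix
transpose M = mat (m11 M) (m21 M) (m12 M) (m22 M)

converse : Digraph → Digraph
converse D = digraph (n D) (λ u v → arc D v u) (loopless D)

entry-transpose : ∀ M i j → entry (transpose M) i j ≡ entry M j i
entry-transpose M zero       zero       = refl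
entry-transpose M zero       (suc zero) = refl
entry-transpose M (suc zero) zero       = refl
entry-transpose M (suc zero) (suc zero) = refl

partition-converse : MPartition M D → MPartition (transpose M) (converse D)
partition-converse {M} {D} P = record
  { part = part
  ; ok = λ u v u≢v →
      subst (λ e → Respects e (arc D v u)) (sym (entry-transpose M (part u) (part v))) (ok v u (u≢v ∘ sym)) }
  where open MPartition P

-- Both transposition and the converse are definitional involutions.
minObs-converse : MinObs (transpose M) D → MinObs M (converse D)
minObs-converse (¬P , proper) =
  ¬P ∘ partition-converse , λ m f f-inj m<n → partition-converse (proper m f f-inj m<n)

converse-≅ : D ≅ E → converse D ≅ converse E
converse-≅ i = record
  { to = I.to ; from = I.from ; from∘to = I.from∘to ; to∘from = I.to∘from ; preserve = λ u v → I.preserve v u }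
  where module I = _≅_ i

Finite : Matrix → Set
Finite M = Σ (List Digraph) λ L → ∀ D → MinObs M D → Any (D ≅_) L

finite-transpose : Finite M → Finite (transpose M)
finite-transpose (L , complete) =
  map converse L , λ D minObs → Any.map⁺ (Any.map converse-≅ (complete (converse D) (minObs-converse minObs)))

offDiagonal : Fin k → Fin k → Bool → Bool
offDiagonal i j b with i ≟ j
... | yes _ = false
... | no _  = b

offDiagonal-diagonal : ∀ (i : Fin k) b → offDiagonal i i b ≡ false
offDiagonal-diagonal i b with i ≟ i
... | yes _  = refl
... | no i≢i = contradiction refl i≢i

fromAdjacencyMatrix : ∀ k → Vec (Vec Bool k) k → Digraph
fromAdjacencyMatrix k rows =
  digraph k (λ i j → offDiagonal i j (lookup (lookup rows i) j)) (λ i → offDiagonal-diagonal i _)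

adjacencyMatrix : (D : Digraph) → Vec (Vec Bool (n D)) (n D)
adjacencyMatrix D = tabulate λ u → tabulate λ v → arc D u v

≅-fromAdjacencyMatrix : ∀ D → D ≅ fromAdjacencyMatrix (n D) (adjacencyMatrix D)
≅-fromAdjacencyMatrix D = record
  { to = λ u → u ; from = λ u → u ; from∘to = λ _ → refl ; to∘from = λ _ → refl ; preserve = preserve }
  where
  preserve : ∀ u v → offDiagonal u v (lookup (lookup (adjacencyMatrix D) u) v) ≡ arc D u v
  preserve u v with u ≟ v
  ... | yes refl = sym (loopless D u)
  ... | no _     = trans (cong (λ row → lookup row v) (lookup∘tabulate _ u)) (lookup∘tabulate _ v)

digraphsOn : ℕ → List Digraph
digraphsOn k = map (fromAdjacencyMatrix k) (vectors (vectors (true ∷ false ∷ []) k) k)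

digraphsOn-complete : ∀ D → Any (D ≅_) (digraphsOn (n D))
digraphsOn-complete D =
  Any.map⁺ (lose (∈-vectors (∈-vectors bool∈) (adjacencyMatrix D)) (≅-fromAdjacencyMatrix D))
  where
  bool∈ : ∀ b → b ∈ true ∷ false ∷ []
  bool∈ true  = here refl
  bool∈ false = there (here refl)

⟺-trans : {A B C : Set} → A ⟺ B → B ⟺ C → A ⟺ C
⟺-trans (f , g) (h , k) = h ∘ f , g ∘ k

finite-M3 : Finite M3
finite-M3 = digraphsOn 3 ++ P3 ∷ C4mixed ∷ [] , λ D → listed D ∘ proj₁ (M3-characterisation D)
  where
  onThree : ∀ D → n D ≡ 3 → Any (D ≅_) (digraphsOn 3 ++ P3 ∷ C4mixed ∷ [])
  onThree D three = Any.++⁺ˡ (subst (λ k → Any (D ≅_) (digraphsOn k)) three (digraphsOn-complete D))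
  listed : ∀ D → M3-Obstruction D → Any (D ≅_) (digraphsOn 3 ++ P3 ∷ C4mixed ∷ [])
  listed D (inj₁ (three , _))        = onThree D three
  listed D (inj₂ (inj₁ (three , _))) = onThree D three
  listed D (inj₂ (inj₂ (inj₁ i)))    = Any.++⁺ʳ (digraphsOn 3) (here i)
  listed D (inj₂ (inj₂ (inj₂ i)))    = Any.++⁺ʳ (digraphsOn 3) (there (here i))

finite-byList : (Hs : List Digraph) → (∀ D → MinObs M D ⟺ Any (D ≅_) Hs) → Finite M
finite-byList Hs characterised = Hs , λ D → proj₁ (characterised D)

finite : (M : Matrix) → m11 M ≡ e0 → m22 M ≡ e0 → M ≢ M1 → Finite M
finite (mat .e0 e0 e0 .e0) refl refl _ = finite-byList M6-obstructions M6-characterisation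
finite (mat .e0 e0 e1 .e0) refl refl _ = finite-byList M4-obstructions M4-characterisation
finite (mat .e0 e0 e* .e0) refl refl _ = finite-byList M2-obstructions M2-characterisation
finite (mat .e0 e1 e0 .e0) refl refl _ = finite-transpose (finite-byList M4-obstructions M4-characterisation)
finite (mat .e0 e1 e1 .e0) refl refl _ = finite-byList M5-obstructions M5-characterisation
finite (mat .e0 e1 e* .e0) refl refl _ = finite-M3
finite (mat .e0 e* e0 .e0) refl refl _ = finite-transpose (finite-byList M2-obstructions M2-characterisation)
finite (mat .e0 e* e1 .e0) refl refl _ = finite-transpose finite-M3
finite (mat .e0 e* e* .e0) refl refl M≢M1 = contradiction refl M≢M1

theorem1 :
    ((M : Matrix) → m11 M ≡ e0 → m22 M ≡ e0 → M ≢ M1 →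
      Σ (List Digraph) λ L → ∀ D → MinObs M D → Any (D ≅_) L)
    ×
    (∀ D → MinObs M2 D ⟺
      (D ≅ digon ⊎ D ≅ P3 ⊎ D ≅ TT3 ⊎ D ≅ C3))
    ×
    (∀ D → MinObs M3 D ⟺
      (UnderlyingK3 D ⊎ UnderlyingK1K2 D ⊎ D ≅ P3 ⊎ D ≅ C4mixed))
    ×
    (∀ D → MinObs M4 D ⟺
      (D ≅ digon ⊎ D ≅ TT3 ⊎ D ≅ C3 ⊎ D ≅ arcK1 ⊎ D ≅ P3))
    ×
    (∀ D → MinObs M5 D ⟺
      (D ≅ asymArc ⊎ D ≅ biK3 ⊎ D ≅ biK1K2))
    ×
    (∀ D → MinObs M6 D ⟺
      (D ≅ asymArc ⊎ D ≅ digon))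
theorem1 =
  finite ,
  (λ D → ⟺-trans (M2-characterisation D) (any⟺alternatives M2-obstructions)) ,
  M3-characterisation ,
  (λ D → ⟺-trans (M4-characterisation D) (any⟺alternatives M4-obstructions)) ,
  (λ D → ⟺-trans (M5-characterisation D) (any⟺alternatives M5-obstructions)) ,
  (λ D → ⟺-trans (M6-characterisation D) (any⟺alternatives M6-obstructions))
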